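{- Let $G$ be a minimal counterexample to the odd Hadwiger's conjecture for the case $t$. Then there is no separation $(A,B)$ of $G$ of order at most $t-3$ such that $A-B$ or $B-A$ is bipartite.
   Context: A separation of $G$ is a pair $(A,B)$ of subgraphs with $A\cup B=G$, $V(A)\setminus V(B)\neq\emptyset$ and $V(B)\setminus V(A)\neq\emptyset$; its order is $|V(A)\cap V(B)|$; $A-B$ denotes the subgraph of $G$ induced by $V(A)\setminus V(B)$. A graph contains an odd $K_t$-minor if there are $t$ vertex-disjoint trees such that every two are joined by an edge, and the vertices of the trees can be 2-colored so that edges inside trees are bichromatic and the chosen edges between trees are monochromatic. An odd-minor-operation consists of deleting vertices and edges, then choosing an edge cut $R$ and contracting all edges of $R$. A minimal counterexample to the odd Hadwiger's conjecture for the case $t$ is a graph $G$ with chromatic number $t$, such that no proper odd minor of $G$ has chromatic number $t$, and $G$ does not contain an odd $K_t$-minor. -}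

module Defs where

open import Level using (0ℓ)
open import Data.Nat using (ℕ; _≤_; _<_; _+_)
open import Data.Fin using (Fin)
open import Data.Fin.Subset using (Subset; _∈_; _∉_; _∩_; ∣_∣)
open import Data.Bool using (Bool)
open import Data.Maybe using (Maybe; just)
open import Data.Product using (Σ; ∃; _×_; _,_)
open import Data.Sum using (_⊎_)
open import Relation.Nullary using (¬_)
open import Relation.Binary.PropositionalEquality using (_≡_; _≢_)
open import Relation.Binary.Construct.Closure.ReflexiveTransitive using (Star)
open import Function.Bundles using (_⤖_; Bijection)
open import Function.Base using (_∘_)

record SimpleGraph : Set₁ where
  field
    n      : ℕ
    E      : Fin n → Fin n → Set
    sym    : ∀ {u v} → E u v → E v u
    irrefl : ∀ {u} → ¬ E u u
open SimpleGraph public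

Colorable : ℕ → SimpleGraph → Set
Colorable k G = Σ (Fin (n G) → Fin k) λ c →
  ∀ u v → E G u v → c u ≢ c v

HasChromaticNumber : SimpleGraph → ℕ → Set
HasChromaticNumber G k = Colorable k G × (∀ j → j < k → ¬ Colorable j G)

Iso : SimpleGraph → SimpleGraph → Set
Iso G H = Σ (Fin (n G) ⤖ Fin (n H)) λ σ →
  ∀ u v → (E G u v → E H (Bijection.to σ u) (Bijection.to σ v))
        × (E H (Bijection.to σ u) (Bijection.to σ v) → E G u v)

-- H is obtained from G by one odd-minor-operation:
--  * deletion of vertices and edges: G' is given by an injective
--    map ι : V(G') → V(G) along which every edge of G' is an edge of G
--    (G' is a subgraph of G, up to relabelling);
--  * an edge cut R = δ(X) of G', X ⊆ V(G') given by a Bool-labelling;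
--  * contraction of all edges of R: f : V(G') → V(H) is surjective and
--    identifies exactly the vertices joined by a path of R-edges; ab is
--    an edge of H iff a ≠ b and some edge of G' maps to ab
--    (loops arising from contraction are discarded, parallel edges merged).

record OddMinorStep (G H : SimpleGraph) : Set₁ where
  field
    G'       : SimpleGraph
    ι        : Fin (n G') → Fin (n G)
    ι-inj    : ∀ u v → ι u ≡ ι v → u ≡ v
    ι-edge   : ∀ u v → E G' u v → E G (ι u) (ι v)
    X        : Fin (n G') → Bool
    f        : Fin (n G') → Fin (n H)
    f-surj   : ∀ a → ∃ λ u → f u ≡ a
    f-ident  : ∀ u v →
      (f u ≡ f v → Star (λ x y → E G' x y × X x ≢ X y) u v)
      × (Star (λ x y → E G' x y × X x ≢ X y) u v → f u ≡ f v)
    H-edge   : ∀ a b →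
      (E H a b → a ≢ b × Σ (Fin (n G')) λ u → Σ (Fin (n G')) λ v →
                   f u ≡ a × f v ≡ b × E G' u v)
      × (a ≢ b → (Σ (Fin (n G')) λ u → Σ (Fin (n G')) λ v →
                   f u ≡ a × f v ≡ b × E G' u v) → E H a b)

OddMinor : SimpleGraph → SimpleGraph → Set₁
OddMinor H G = Star OddMinorStep G H

ProperOddMinor : SimpleGraph → SimpleGraph → Set₁
ProperOddMinor H G = OddMinor H G × ¬ Iso H G

-- Odd K_t-minor: t vertex-disjoint trees T_1..T_t (vertex v lies in
-- tree `branch v`, or in none), a 2-colouring `col` of the vertices,
-- tree edges bichromatic, and for every two trees a monochromatic edge
-- of G joining them.  A tree with bichromatic edges on a vertex set S
-- exists iff S is nonempty and S is connected by bichromatic edges of G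
-- inside S (take a spanning tree); that is how trees are encoded.

record OddCliqueMinor (t : ℕ) (G : SimpleGraph) : Set where
  field
    branch    : Fin (n G) → Maybe (Fin t)
    col       : Fin (n G) → Bool
    nonempty  : ∀ i → ∃ λ v → branch v ≡ just i
    connected : ∀ i u v → branch u ≡ just i → branch v ≡ just i →
      Star (λ x y → branch x ≡ just i × branch y ≡ just i
                    × E G x y × col x ≢ col y) u v
    adjacent  : ∀ i j → i ≢ j →
      Σ (Fin (n G)) λ u → Σ (Fin (n G)) λ v →
        branch u ≡ just i × branch v ≡ just j × E G u v × col u ≡ col v

HasOddKMinor : ℕ → SimpleGraph → Set
HasOddKMinor t G = OddCliqueMinor t G

record MinimalCounterexample (t : ℕ) (G : SimpleGraph) : Set₁ where
  field
    chrom    : HasChromaticNumber G t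
    minimal  : ∀ H → ProperOddMinor H G → ¬ HasChromaticNumber H t
    no-minor : ¬ HasOddKMinor t G

record Separation (G : SimpleGraph) : Set₁ where
  field
    VA VB   : Subset (n G)
    EA EB   : Fin (n G) → Fin (n G) → Set
    EA-sub  : ∀ u v → EA u v → E G u v × u ∈ VA × v ∈ VA
    EB-sub  : ∀ u v → EB u v → E G u v × u ∈ VB × v ∈ VB
    V-cover : ∀ v → v ∈ VA ⊎ v ∈ VB
    E-cover : ∀ u v → E G u v → EA u v ⊎ EB u v
    A-B≠∅   : ∃ λ v → v ∈ VA × v ∉ VB
    B-A≠∅   : ∃ λ v → v ∈ VB × v ∉ VA

  order : ℕ
  order = ∣ VA ∩ VB ∣
open Separation public

InducedBipartite : (G : SimpleGraph) → (Fin (n G) → Set) → Set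
InducedBipartite G S = Σ (Fin (n G) → Bool) λ c →
  ∀ u v → S u → S v → E G u v → c u ≢ c v

A-B-Bipartite : (G : SimpleGraph) → Separation G → Set
A-B-Bipartite G s = InducedBipartite G (λ v → v ∈ VA s × v ∉ VB s)

B-A-Bipartite : (G : SimpleGraph) → Separation G → Set
B-A-Bipartite G s = InducedBipartite G (λ v → v ∈ VB s × v ∉ VA s)

module Submission where

-- Let G be a minimal counterexample for t and (A,B) a separation of order
-- k ≤ t - 3 whose side A - B is bipartite (the case B - A is symmetric).
-- Pick a vertex v of A - B.  Deleting v is a single odd-minor-operation, and
-- G - v has fewer vertices, so G - v is a proper odd minor of G; by
-- minimality χ(G - v) ≠ t.  We show χ(G - v) = t anyway:
--   * G - v is t-colourable, being a subgraph of G;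
--   * a colouring of G - v with fewer than t colours is, up to the colour of
--     v, a (t-1)-colouring of G off A - B.  Since k + 2 ≤ t - 1, two colours
--     α ≠ β are unused on the separator V(A) ∩ V(B); recolouring the
--     bipartite graph A - B with α and β gives a proper (t-1)-colouring of G,
--     because every neighbour of A - B outside it lies in the separator.
--     This contradicts χ(G) = t.

open import Defs
open import Data.Nat using (ℕ; _≤_; _+_)
open import Data.Product using (Σ; _×_)
open import Data.Sum using (_⊎_)
open import Relation.Nullary using (¬_)

open import Data.Nat using (zero; suc; pred; _<_; s≤s; z≤n; s≤s⁻¹)
open import Data.Nat.Properties using (≤-trans; <⇒≱; +-comm; +-suc; m≤n+m; n≤1+n; n<1+n; 1+n≰n)
open import Data.Fin using (Fin; punchIn; punchOut; inject≤; fromℕ<; _≟_)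
  renaming (zero to fzero; suc to fsuc)
open import Data.Fin.Properties
  using (any?; punchIn-injective; punchIn-punchOut; inject≤-injective; injective⇒≤;
         0≢1+n; suc-injective)
open import Data.Fin.Subset using (Subset; _∈_; _∉_; _∩_; ∣_∣; _-_; inside)
open import Data.Fin.Subset.Properties using (_∈?_; x∈p∧x≢y⇒x∈p-y; x∈p⇒∣p-x∣<∣p∣; x∈p∩q⁺; ∩-comm)
open import Data.Vec.Base using (_∷_; here; there)
open import Data.Product using (_,_; ∃; proj₁; proj₂)
open import Data.Sum using (inj₁; inj₂)
open import Data.Bool using (Bool; true; false)
open import Data.Empty using (⊥-elim)
open import Relation.Nullary using (Dec; yes; no; ¬?; contradiction)
open import Relation.Nullary.Decidable using (_×-dec_)
open import Relation.Binary.PropositionalEquality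
  using (_≡_; _≢_; refl; trans; cong; subst; subst₂) renaming (sym to ≡-sym)
open import Relation.Binary.Construct.Closure.ReflexiveTransitive using (Star; ε; _◅_)
open import Function.Base using (_∘_)
open import Function.Bundles using (Bijection)
open import Function.Definitions using (Injective)
open import Function.Properties.Bijection using (sym-≡)

injection-into-subset : ∀ {n m} (S : Subset n) (g : Fin m → Fin n) →
  Injective _≡_ _≡_ g → (∀ i → g i ∈ S) → m ≤ ∣ S ∣
injection-into-subset {m = zero} S g g-inj g∈S = z≤n
injection-into-subset {m = suc m} S g g-inj g∈S =
  ≤-trans (s≤s (injection-into-subset (S - g fzero) (g ∘ fsuc) (suc-injective ∘ g-inj) rest∈S-g₀))
          (x∈p⇒∣p-x∣<∣p∣ (g∈S fzero))
  where
    rest∈S-g₀ : ∀ i → g (fsuc i) ∈ S - g fzero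
    rest∈S-g₀ i = x∈p∧x≢y⇒x∈p-y (g∈S (fsuc i)) (λ eq → 0≢1+n (g-inj (≡-sym eq)))

module _ {n k : ℕ} (col : Fin n → Fin k) (S : Subset n) where

  UsedOn : Fin k → Set
  UsedOn a = ∃ λ u → u ∈ S × col u ≡ a

  used? : ∀ a → Dec (UsedOn a)
  used? a = any? (λ u → (u ∈? S) ×-dec (col u ≟ a))

  -- A set of fewer than k vertices misses some colour: otherwise choosing a
  -- vertex of each colour would inject all k colours into S.
  free-colour : ∣ S ∣ < k → ∃ λ a → ¬ UsedOn a
  free-colour ∣S∣<k with any? (λ a → ¬? (used? a))
  ... | yes found = found
  ... | no none = contradiction (injection-into-subset S witness witness-injective witness∈S)
                                (<⇒≱ ∣S∣<k)
    where
      used : ∀ a → UsedOn a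
      used a with used? a
      ... | yes u = u
      ... | no ¬u = ⊥-elim (none (a , ¬u))
      witness : Fin k → Fin n
      witness a = proj₁ (used a)
      witness∈S : ∀ a → witness a ∈ S
      witness∈S a = proj₁ (proj₂ (used a))
      witness-injective : Injective _≡_ _≡_ witness
      witness-injective {a} {b} eq =
        trans (≡-sym (proj₂ (proj₂ (used a))))
              (trans (cong col eq) (proj₂ (proj₂ (used b))))

-- A set S with |S| + 2 ≤ k misses two distinct colours.  The second one is a
-- colour missed by S together with an extra vertex coloured by the first.
two-free-colours : ∀ {n k} (col : Fin n → Fin k) (S : Subset n) → ∣ S ∣ + 2 ≤ k →
  Σ (Fin k) λ α → Σ (Fin k) λ β → α ≢ β × ¬ UsedOn col S α × ¬ UsedOn col S β
two-free-colours {n} {k} col S ∣S∣+2≤k = α , β , α≢β , α-free , β-free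
  where
    2+∣S∣≤k : suc (suc ∣ S ∣) ≤ k
    2+∣S∣≤k = subst (_≤ k) (+-comm ∣ S ∣ 2) ∣S∣+2≤k

    α-free-colour : ∃ λ a → ¬ UsedOn col S a
    α-free-colour = free-colour col S (≤-trans (n≤1+n (suc ∣ S ∣)) 2+∣S∣≤k)
    α : Fin k
    α = proj₁ α-free-colour
    α-free : ¬ UsedOn col S α
    α-free = proj₂ α-free-colour

    col⁺ : Fin (suc n) → Fin k
    col⁺ fzero = α
    col⁺ (fsuc u) = col u

    β-free-colour : ∃ λ b → ¬ UsedOn col⁺ (inside ∷ S) b
    β-free-colour = free-colour col⁺ (inside ∷ S) 2+∣S∣≤k
    β : Fin k
    β = proj₁ β-free-colour
    α≢β : α ≢ β
    α≢β α≡β = proj₂ β-free-colour (fzero , here , α≡β)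
    β-free : ¬ UsedOn col S β
    β-free (u , u∈S , col-u≡β) = proj₂ β-free-colour (fsuc u , there u∈S , col-u≡β)

Private : ∀ {n} → Subset n → Subset n → Fin n → Set
Private VA VB u = u ∈ VA × u ∉ VB

private? : ∀ {n} (VA VB : Subset n) u → Dec (Private VA VB u)
private? VA VB u = (u ∈? VA) ×-dec ¬? (u ∈? VB)

EdgesCovered : (G : SimpleGraph) → Subset (n G) → Subset (n G) → Set
EdgesCovered G VA VB = ∀ u w → E G u w → (u ∈ VA × w ∈ VA) ⊎ (u ∈ VB × w ∈ VB)

separation-covers : ∀ {G} (s : Separation G) → EdgesCovered G (VA s) (VB s)
separation-covers s u w e with E-cover s u w e
... | inj₁ e∈A = inj₁ (proj₂ (EA-sub s u w e∈A))
... | inj₂ e∈B = inj₂ (proj₂ (EB-sub s u w e∈B))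

covers-swap : ∀ {G VA VB} → EdgesCovered G VA VB → EdgesCovered G VB VA
covers-swap cover u w e with cover u w e
... | inj₁ inA = inj₂ inA
... | inj₂ inB = inj₁ inB

private-neighbour : ∀ {G VA VB} → EdgesCovered G VA VB → ∀ {u w} →
  Private VA VB u → ¬ Private VA VB w → E G u w → w ∈ VA ∩ VB
private-neighbour {VB = VB} cover {u} {w} (u∈A , u∉B) w-shared e with cover u w e
... | inj₂ (u∈B , _) = ⊥-elim (u∉B u∈B)
... | inj₁ (_ , w∈A) with w ∈? VB
...   | yes w∈B = x∈p∩q⁺ (w∈A , w∈B)
...   | no w∉B = ⊥-elim (w-shared (w∈A , w∉B))

-- Colour A - B with two colours unused on the
-- separator, following its bipartition, and keep c elsewhere.
recolour-private-side : ∀ {k} (G : SimpleGraph) (VA VB : Subset (n G)) →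
  EdgesCovered G VA VB → InducedBipartite G (Private VA VB) →
  (c : Fin (n G) → Fin k) →
  (∀ u w → ¬ Private VA VB u → ¬ Private VA VB w → E G u w → c u ≢ c w) →
  ∣ VA ∩ VB ∣ + 2 ≤ k → Colorable k G
recolour-private-side {k} G VA VB cover (side , side-proper) c c-proper small =
  d , d-proper
  where
    free : Σ (Fin k) λ α → Σ (Fin k) λ β →
             α ≢ β × ¬ UsedOn c (VA ∩ VB) α × ¬ UsedOn c (VA ∩ VB) β
    free = two-free-colours c (VA ∩ VB) small
    α β : Fin k
    α = proj₁ free
    β = proj₁ (proj₂ free)
    α≢β : α ≢ β
    α≢β = proj₁ (proj₂ (proj₂ free))

    side-colour : Bool → Fin k
    side-colour true = α
    side-colour false = β

    side-colour-injective : ∀ x y → x ≢ y → side-colour x ≢ side-colour y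
    side-colour-injective true true x≢y = ⊥-elim (x≢y refl)
    side-colour-injective true false _ = α≢β
    side-colour-injective false true _ = α≢β ∘ ≡-sym
    side-colour-injective false false x≢y = ⊥-elim (x≢y refl)

    side-colour-free : ∀ x → ¬ UsedOn c (VA ∩ VB) (side-colour x)
    side-colour-free true = proj₁ (proj₂ (proj₂ (proj₂ free)))
    side-colour-free false = proj₂ (proj₂ (proj₂ (proj₂ free)))

    boundary : ∀ u w → Private VA VB u → ¬ Private VA VB w → E G u w →
      side-colour (side u) ≢ c w
    boundary u w u-private w-shared e eq =
      side-colour-free (side u) (w , private-neighbour {G} cover u-private w-shared e , ≡-sym eq)

    colour : ∀ u → Dec (Private VA VB u) → Fin k
    colour u (yes _) = side-colour (side u)
    colour u (no _) = c u

    d : Fin (n G) → Fin k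
    d u = colour u (private? VA VB u)

    colour-proper : ∀ u w (pu : Dec (Private VA VB u)) (pw : Dec (Private VA VB w)) →
      E G u w → colour u pu ≢ colour w pw
    colour-proper u w (yes pu) (yes pw) e = side-colour-injective _ _ (side-proper u w pu pw e)
    colour-proper u w (yes pu) (no ¬pw) e = boundary u w pu ¬pw e
    colour-proper u w (no ¬pu) (yes pw) e = boundary w u pw ¬pu (sym G e) ∘ ≡-sym
    colour-proper u w (no ¬pu) (no ¬pw) e = c-proper u w ¬pu ¬pw e

    d-proper : ∀ u w → E G u w → d u ≢ d w
    d-proper u w = colour-proper u w (private? VA VB u) (private? VA VB w)

skip : ∀ {m} → Fin m → Fin (pred m) → Fin m
skip {suc _} v = punchIn v

unskip : ∀ {m} (v u : Fin m) → v ≢ u → Fin (pred m)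
unskip {suc _} v u v≢u = punchOut v≢u

skip-injective : ∀ {m} (v : Fin m) → Injective _≡_ _≡_ (skip v)
skip-injective {suc _} v = punchIn-injective v _ _

skip-unskip : ∀ {m} (v u : Fin m) (v≢u : v ≢ u) → skip v (unskip v u v≢u) ≡ u
skip-unskip {suc _} v u v≢u = punchIn-punchOut v≢u

_─_ : (G : SimpleGraph) → Fin (n G) → SimpleGraph
G ─ v = record
  { n = pred (n G)
  ; E = λ a b → E G (skip v a) (skip v b)
  ; sym = sym G
  ; irrefl = irrefl G
  }

-- Deleting a vertex is one odd-minor-operation: embed G - v into G, take
-- the empty edge cut (X constant) and contract nothing.
deletion-step : ∀ G v → OddMinorStep G (G ─ v)
deletion-step G v = record
  { G' = G ─ v
  ; ι = skip v
  ; ι-inj = λ _ _ → skip-injective v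
  ; ι-edge = λ _ _ e → e
  ; X = λ _ → true
  ; f = λ a → a
  ; f-surj = λ a → a , refl
  ; f-ident = λ _ _ → (λ { refl → ε }) , no-cut-path
  ; H-edge = λ a b → (λ e → (λ { refl → irrefl G e }) , a , b , refl , refl , e)
                   , (λ { _ (_ , _ , refl , refl , e) → e })
  }
  where
    no-cut-path : ∀ {a b} → Star (λ x y → E (G ─ v) x y × true ≢ true) a b → a ≡ b
    no-cut-path ε = refl
    no-cut-path ((_ , true≢true) ◅ _) = ⊥-elim (true≢true refl)

-- G - v has fewer vertices than G, so it is not isomorphic to G.
deletion-not-iso : ∀ G v → ¬ Iso (G ─ v) G
deletion-not-iso G v (σ , _) = fewer v (injective⇒≤ (Bijection.injective (sym-≡ σ)))
  where
    fewer : ∀ {m} → Fin m → ¬ (m ≤ pred m)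
    fewer {suc m} _ = 1+n≰n

deletion-proper-minor : ∀ G v → ProperOddMinor (G ─ v) G
deletion-proper-minor G v = deletion-step G v ◅ ε , deletion-not-iso G v

restrict-colouring : ∀ {k} G v → Colorable k G → Colorable k (G ─ v)
restrict-colouring G v (c , c-proper) = c ∘ skip v , λ a b → c-proper (skip v a) (skip v b)

extend-colouring : ∀ {k} G v → Colorable k (G ─ v) → Fin k →
  Σ (Fin (n G) → Fin k) λ c → ∀ u w → u ≢ v → w ≢ v → E G u w → c u ≢ c w
extend-colouring {k} G v (c' , c'-proper) default = c , c-proper
  where
    c : Fin (n G) → Fin k
    c u with v ≟ u
    ... | yes _ = default
    ... | no v≢u = c' (unskip v u v≢u)

    c-proper : ∀ u w → u ≢ v → w ≢ v → E G u w → c u ≢ c w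
    c-proper u w u≢v w≢v e with v ≟ u | v ≟ w
    ... | yes v≡u | _ = ⊥-elim (u≢v (≡-sym v≡u))
    ... | no _ | yes v≡w = ⊥-elim (w≢v (≡-sym v≡w))
    ... | no v≢u | no v≢w =
      c'-proper _ _ (subst₂ (E G) (≡-sym (skip-unskip v u v≢u)) (≡-sym (skip-unskip v w v≢w)) e)

colourable-mono : ∀ {j k} G → j ≤ k → Colorable j G → Colorable k G
colourable-mono G j≤k (c , c-proper) =
  (λ u → inject≤ (c u) j≤k) ,
  (λ u w e eq → c-proper u w e (inject≤-injective j≤k j≤k _ _ eq))

private-deletion-keeps-χ : ∀ {t} G (VA VB : Subset (n G)) → EdgesCovered G VA VB →
  InducedBipartite G (Private VA VB) → ∀ v → Private VA VB v →
  ∣ VA ∩ VB ∣ + 2 ≤ t → HasChromaticNumber G (suc t) → HasChromaticNumber (G ─ v) (suc t)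
private-deletion-keeps-χ {t} G VA VB cover bipartite v v-private small (colourable , minimum) =
  restrict-colouring G v colourable , no-smaller-colouring
  where
    -- some colour of Fin t exists, since t ≥ 2
    default : Fin t
    default = fromℕ< (≤-trans (s≤s z≤n) (subst (_≤ t) (+-comm ∣ VA ∩ VB ∣ 2) small))

    not-v : ∀ {u} → ¬ Private VA VB u → u ≢ v
    not-v ¬private refl = ¬private v-private

    G-colourable : Colorable t (G ─ v) → Colorable t G
    G-colourable colouring with extend-colouring G v colouring default
    ... | c , c-proper =
      recolour-private-side G VA VB cover bipartite c
        (λ u w ¬pu ¬pw → c-proper u w (not-v ¬pu) (not-v ¬pw)) small

    no-smaller-colouring : ∀ j → j < suc t → ¬ Colorable j (G ─ v)
    no-smaller-colouring j j<1+t colouring =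
      minimum t (n<1+n t) (G-colourable (colourable-mono (G ─ v) (s≤s⁻¹ j<1+t) colouring))

no-bipartite-private-side : ∀ {t G} → MinimalCounterexample t G →
  (VA VB : Subset (n G)) → EdgesCovered G VA VB → ∀ v → Private VA VB v →
  ∣ VA ∩ VB ∣ + 3 ≤ t → ¬ InducedBipartite G (Private VA VB)
no-bipartite-private-side {zero} mc VA VB cover v v-private small _ =
  contradiction (≤-trans (m≤n+m 3 ∣ VA ∩ VB ∣) small) λ ()
no-bipartite-private-side {suc t} {G} mc VA VB cover v v-private small bipartite =
  MinimalCounterexample.minimal mc (G ─ v) (deletion-proper-minor G v)
    (private-deletion-keeps-χ G VA VB cover bipartite v v-private small-sep
      (MinimalCounterexample.chrom mc))
  where
    small-sep : ∣ VA ∩ VB ∣ + 2 ≤ t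
    small-sep = s≤s⁻¹ (subst (_≤ suc t) (+-suc ∣ VA ∩ VB ∣ 2) small)

lemma7p5 : (t : ℕ) (G : SimpleGraph) → MinimalCounterexample t G →
    ¬ (Σ (Separation G) λ s → (order s + 3 ≤ t)
        × (A-B-Bipartite G s ⊎ B-A-Bipartite G s))
lemma7p5 t G mc (s , small , inj₁ A-B-bipartite) =
  no-bipartite-private-side mc (VA s) (VB s) (separation-covers {G} s)
    (proj₁ (A-B≠∅ s)) (proj₂ (A-B≠∅ s)) small A-B-bipartite
lemma7p5 t G mc (s , small , inj₂ B-A-bipartite) =
  no-bipartite-private-side mc (VB s) (VA s) (covers-swap {G} (separation-covers {G} s))
    (proj₁ (B-A≠∅ s)) (proj₂ (B-A≠∅ s))
    (subst (λ S → ∣ S ∣ + 3 ≤ t) (∩-comm (VA s) (VB s)) small) B-A-bipartite
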